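{- Let $m\geq 1$ and $n\geq 1$ be integers and let $F_{n,m}=E_n+P_m$. Then $$\alpha(F_2(F_{n,m}))=\begin{cases} n\left\lceil\frac{m}{2}\right\rceil+\binom{\lfloor m/2\rfloor}{2} & \text{if } n\in\{\frac{m+1}{2},\frac{m+3}{2}\},\\[2pt] \left\lfloor\frac{m^2}{4}\right\rfloor+\binom{n}{2} & \text{otherwise.}\end{cases}$$
   Context: $E_n$ is the edgeless graph on $n$ vertices and $P_m$ the path on $m$ vertices. The join $G_1+G_2$ of disjoint graphs has vertex set $V(G_1)\cup V(G_2)$ and edge set $E(G_1)\cup E(G_2)\cup\{uv: u\in V(G_1), v\in V(G_2)\}$. For a finite simple graph $G$, the $2$-token graph $F_2(G)$ has as vertices the $2$-element subsets of $V(G)$, two adjacent iff their symmetric difference is an edge of $G$. $\alpha$ is the independence number, and $\binom{j}{k}=0$ when $j<k$. -}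

module Defs where

open import Level using (0ℓ)
open import Data.Nat using (ℕ; suc; _+_; _≤_)
open import Data.Fin using (Fin; toℕ; splitAt)
open import Data.Fin.Subset using (Subset; _∪_; _─_; ⁅_⁆; ∣_∣)
open import Data.Sum using (_⊎_; inj₁; inj₂)
open import Data.Product using (Σ; ∃; ∃-syntax; _×_; _,_)
open import Data.Empty using (⊥)
open import Data.Unit using (⊤)
open import Data.List using (List; length)
open import Data.List.Membership.Propositional using (_∈_)
open import Data.List.Relation.Unary.Unique.Propositional using (Unique)
open import Relation.Nullary using (¬_)
open import Relation.Binary.PropositionalEquality using (_≡_; _≢_)

record Graph : Set₁ where
  field
    V   : Set
    Adj : V → V → Set
open Graph public

-- Finite simple graphs on vertex set Fin N (adjacency relation only;
-- the concrete graphs below are symmetric and irreflexive).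
FinGraph : ℕ → Set₁
FinGraph N = Fin N → Fin N → Set

Edgeless : (n : ℕ) → FinGraph n
Edgeless n i j = ⊥

Path : (m : ℕ) → FinGraph m
Path m i j = (suc (toℕ i) ≡ toℕ j) ⊎ (suc (toℕ j) ≡ toℕ i)

Join : {n m : ℕ} → FinGraph n → FinGraph m → FinGraph (n + m)
Join {n} {m} G₁ G₂ i j with splitAt n i | splitAt n j
... | inj₁ a | inj₁ b = G₁ a b
... | inj₂ a | inj₂ b = G₂ a b
... | inj₁ _ | inj₂ _ = ⊤
... | inj₂ _ | inj₁ _ = ⊤

TokenGraph₂ : {N : ℕ} → FinGraph N → Graph
TokenGraph₂ {N} G = record
  { V   = Σ (Subset N) (λ A → ∣ A ∣ ≡ 2)
  ; Adj = λ { (A , _) (B , _) →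
        ∃[ x ] ∃[ y ] (G x y × ((A ─ B) ∪ (B ─ A)) ≡ (⁅ x ⁆ ∪ ⁅ y ⁆)) }
  }

IsIndependent : (H : Graph) → List (V H) → Set
IsIndependent H S = Unique S × (∀ {u v} → u ∈ S → v ∈ S → ¬ Adj H u v)

IndependenceNumber : (H : Graph) → ℕ → Set
IndependenceNumber H k =
  (∃[ S ] (IsIndependent H S × length S ≡ k)) ×
  (∀ S → IsIndependent H S → length S ≤ k)

F : (n m : ℕ) → FinGraph (n + m)
F n m = Join (Edgeless n) (Path m)

{-# OPTIONS --safe #-}
-- Write the vertices of F_{n,m} as edgeless vertices eᵢ (i < n) and path vertices pⱼ (j < m).
--
-- Give the eᵢ a colour of their own and colour pⱼ by the parity of j; this is a
-- proper 3-colouring. For any map σ on colours, the tokens {u, v} with colour v = σ (colour u)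
-- and colour u = σ (colour v) are pairwise non-adjacent in F₂: adjacent tokens {s, x}, {s, y}
-- have x ~ y, yet colour x = σ (colour s) = colour y. Exchanging the colours of the eᵢ and the
-- even pⱼ gives the tokens {eᵢ, p_even} and {p_odd, p_odd}, n ⌈m/2⌉ + C(⌊m/2⌋, 2) of them;
-- exchanging even and odd gives {eᵢ, eⱼ} and {p_even, p_odd}, ⌊m/2⌋ ⌈m/2⌉ + C(n, 2) of them.
--
-- If the tokens of F_{n,m} that are not tokens of F_{n′,m′} are covered by Δ
-- cliques of F₂, then α(F₂(F_{n,m})) ≤ α(F₂(F_{n′,m′})) + Δ. Passing from F_{n,m} to
-- F_{n+1,m+2} adds the triangle T = {eₙ, pₘ, pₘ₊₁}, and the new tokens are covered by n + m + 1
-- cliques: the tokens inside T, and for each old vertex x the tokens {t, x} with t ∈ T. This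
-- step fixes 2n − m and increases both sizes by exactly n + m + 1, which reduces everything to
-- n = 0 or m ≤ 1. There vertices v are added one at a time, and the tokens {v, x} are covered
-- by the n ⊔ ⌈m/2⌉ cliques {eᵢ, p₂ᵢ, p₂ᵢ₊₁} of F_{n,m} that x may lie in; E₃ + P₁ is handled
-- directly.
module Submission where

open import Defs
open import Data.Nat using (ℕ; zero; suc; _+_; _*_; _≤_; _<_; _/_; ⌈_/2⌉; ⌊_/2⌋; _⊔_; z≤n; s≤s; _<?_; _≟_)
open import Data.Nat.Properties
open import Data.Nat.Combinatorics using (_C_; nC1≡n; nCk+nC[k+1]≡[n+1]C[k+1])
open import Data.Nat.DivMod using (m*n/n≡m; +-distrib-/-∣ʳ)
open import Data.Nat.Divisibility using (divides-refl)
open import Data.Nat.Tactic.RingSolver using (solve-∀)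
open import Data.Bool using (true; false; _∨_; _xor_; if_then_else_)
open import Data.Bool.Properties using (∨-zeroʳ; xor-same)
open import Data.Fin using (Fin; zero; suc; toℕ; splitAt; fromℕ<)
import Data.Fin.Properties as Fin
open import Data.Fin.Subset using (Subset; ⁅_⁆; _∪_; _─_; ∣_∣) renaming (⊥ to ∅)
open import Data.Fin.Subset.Properties using (∣⁅x⁆∣≡1; ∪-comm; ∪-identityˡ; ∪-identityʳ)
open import Data.Vec using ([]; _∷_; lookup)
open import Data.Vec.Properties using (lookup-zipWith; lookup-replicate; tabulate∘lookup; tabulate-cong)
open import Data.Sum as Sum using (_⊎_; inj₁; inj₂; [_,_]′)
open import Data.Product using (∃₂; ∃-syntax; _×_; _,_; proj₁; proj₂; swap)
open import Data.Product.Properties using (,-injective)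
open import Data.Empty using (⊥; ⊥-elim)
open import Data.Unit using (⊤; tt)
open import Data.List using (List; []; _∷_; length; map; filter; _++_; upTo; cartesianProductWith)
open import Data.List.Properties using (length-map; length-++; length-upTo)
open import Data.List.Membership.Propositional using (_∈_)
open import Data.List.Membership.Propositional.Properties
  using (∈-filter⁻; ∈-map⁻; ∈-map⁺; ∈-++⁻; ∈-upTo⁻; ∈-cartesianProductWith⁻)
open import Data.List.Relation.Unary.All as All using (All; []; _∷_)
import Data.List.Relation.Unary.All.Properties as All
open import Data.List.Relation.Unary.Any using (here; there)
open import Data.List.Relation.Unary.AllPairs using ([]; _∷_)
open import Data.List.Relation.Unary.Unique.Propositional using (Unique)
import Data.List.Relation.Unary.Unique.Propositional.Properties as Unique
open import Function using (_∘_; id; flip)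
open import Relation.Nullary using (¬_; Dec; yes; no; contradiction)
open import Relation.Nullary.Decidable using (¬?; _×-dec_; does; dec-true; dec-false)
open import Relation.Unary using (Decidable)
open import Relation.Binary.PropositionalEquality

Exceptional : ℕ → ℕ → Set
Exceptional n m = (2 * n ≡ m + 1) ⊎ (2 * n ≡ m + 3)

exceptional-pred : ∀ {n m} → Exceptional (suc n) (suc (suc m)) → Exceptional n m
exceptional-pred {n} = Sum.map drop drop
  where
  drop : ∀ {k} → 2 * suc n ≡ suc (suc k) → 2 * n ≡ k
  drop e = suc-injective (suc-injective (trans (sym (*-suc 2 n)) e))

exceptional-suc : ∀ {n m} → Exceptional n m → Exceptional (suc n) (suc (suc m))
exceptional-suc {n} = Sum.map lift lift
  where
  lift : ∀ {k} → 2 * n ≡ k → 2 * suc n ≡ suc (suc k)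
  lift e = trans (*-suc 2 n) (cong (2 +_) e)

¬exceptional-zeroˡ : ∀ m → ¬ Exceptional 0 m
¬exceptional-zeroˡ m = [ m+1+n≢0 m ∘ sym , m+1+n≢0 m ∘ sym ]′

¬exceptional-zeroʳ : ∀ n → ¬ Exceptional n 0
¬exceptional-zeroʳ n = [ even≢odd n 0 , even≢odd n 1 ]′

exceptional-oneʳ : ∀ n → Exceptional n 1 → n ≡ 1 ⊎ n ≡ 2
exceptional-oneʳ n = Sum.map (*-cancelˡ-≡ n 1 2) (*-cancelˡ-≡ n 2 2)

size₁ size₂ : ℕ → ℕ → ℕ
size₁ n m = n * ⌈ m /2⌉ + ⌊ m /2⌋ C 2
size₂ n m = ⌊ m /2⌋ * ⌈ m /2⌉ + n C 2

suc-C2 : ∀ n → suc n C 2 ≡ n C 2 + n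
suc-C2 n = begin
  suc n C 2       ≡⟨ nCk+nC[k+1]≡[n+1]C[k+1] n 1 ⟨
  n C 1 + n C 2   ≡⟨ cong (_+ n C 2) (nC1≡n n) ⟩
  n + n C 2       ≡⟨ +-comm n (n C 2) ⟩
  n C 2 + n       ∎
  where open ≡-Reasoning

size₁-step : ∀ n m → size₁ (suc n) (suc (suc m)) ≡ size₁ n m + suc (n + m)
size₁-step n m = begin
  suc n * suc h + suc f C 2            ≡⟨ cong (suc n * suc h +_) (suc-C2 f) ⟩
  suc n * suc h + (f C 2 + f)          ≡⟨ ring n h f (f C 2) ⟩
  n * h + f C 2 + suc (n + (f + h))    ≡⟨ cong (λ k → n * h + f C 2 + suc (n + k)) (⌊n/2⌋+⌈n/2⌉≡n m) ⟩
  size₁ n m + suc (n + m)              ∎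
  where
  open ≡-Reasoning
  f = ⌊ m /2⌋
  h = ⌈ m /2⌉
  ring : ∀ n h f c → suc n * suc h + (c + f) ≡ n * h + c + suc (n + (f + h))
  ring = solve-∀

size₂-step : ∀ n m → size₂ (suc n) (suc (suc m)) ≡ size₂ n m + suc (n + m)
size₂-step n m = begin
  suc f * suc h + suc n C 2            ≡⟨ cong (suc f * suc h +_) (suc-C2 n) ⟩
  suc f * suc h + (n C 2 + n)          ≡⟨ ring n h f (n C 2) ⟩
  f * h + n C 2 + suc (n + (f + h))    ≡⟨ cong (λ k → f * h + n C 2 + suc (n + k)) (⌊n/2⌋+⌈n/2⌉≡n m) ⟩
  size₂ n m + suc (n + m)              ∎
  where
  open ≡-Reasoning
  f = ⌊ m /2⌋
  h = ⌈ m /2⌉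
  ring : ∀ n h f c → suc f * suc h + (c + n) ≡ f * h + c + suc (n + (f + h))
  ring = solve-∀

size₂-zero-suc : ∀ m → size₂ 0 m + ⌈ m /2⌉ ≡ size₂ 0 (suc m)
size₂-zero-suc m = ring ⌊ m /2⌋ ⌈ m /2⌉
  where
  ring : ∀ f h → f * h + 0 + h ≡ h * suc f + 0
  ring = solve-∀

m*m/4≡⌊m/2⌋*⌈m/2⌉ : ∀ m → (m * m) / 4 ≡ ⌊ m /2⌋ * ⌈ m /2⌉
m*m/4≡⌊m/2⌋*⌈m/2⌉ zero = refl
m*m/4≡⌊m/2⌋*⌈m/2⌉ (suc zero) = refl
m*m/4≡⌊m/2⌋*⌈m/2⌉ (suc (suc m)) = begin
  (suc (suc m) * suc (suc m)) / 4              ≡⟨ cong (_/ 4) (square m) ⟩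
  (m * m + suc m * 4) / 4                      ≡⟨ +-distrib-/-∣ʳ (m * m) (divides-refl (suc m)) ⟩
  (m * m) / 4 + (suc m * 4) / 4                ≡⟨ cong₂ _+_ (m*m/4≡⌊m/2⌋*⌈m/2⌉ m) (m*n/n≡m (suc m) 4) ⟩
  f * h + suc m                                ≡⟨ cong (λ k → f * h + suc k) (⌊n/2⌋+⌈n/2⌉≡n m) ⟨
  f * h + suc (f + h)                          ≡⟨ expand f h ⟩
  suc f * suc h                                ∎
  where
  open ≡-Reasoning
  f = ⌊ m /2⌋
  h = ⌈ m /2⌉
  square : ∀ m → suc (suc m) * suc (suc m) ≡ m * m + suc m * 4
  square = solve-∀
  expand : ∀ f h → f * h + suc (f + h) ≡ suc f * suc h
  expand = solve-∀

module _ {A : Set} where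

  length-filter-split : ∀ {P : A → Set} (P? : Decidable P) xs →
    length xs ≡ length (filter P? xs) + length (filter (¬? ∘ P?) xs)
  length-filter-split P? [] = refl
  length-filter-split P? (x ∷ xs) with P? x
  ... | yes _ = cong suc (length-filter-split P? xs)
  ... | no _  = trans (cong suc (length-filter-split P? xs)) (sym (+-suc _ _))

  map⁺-injectiveOn : ∀ {B : Set} {f : A → B} {xs} →
    (∀ {x y} → x ∈ xs → y ∈ xs → f x ≡ f y → x ≡ y) → Unique xs → Unique (map f xs)
  map⁺-injectiveOn {xs = []} _ [] = []
  map⁺-injectiveOn {xs = x ∷ xs} inj (x∉xs ∷ unique) =
    All.map⁺ (All.tabulate λ y∈ fx≡fy → All.lookup x∉xs y∈ (inj (here refl) (there y∈) fx≡fy))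
    ∷ map⁺-injectiveOn (λ x∈ y∈ → inj (there x∈) (there y∈)) unique

  preimage-list : ∀ {B : Set} {f : A → B} {ys} → All (λ y → ∃[ x ] f x ≡ y) ys → ∃[ xs ] map f xs ≡ ys
  preimage-list [] = [] , refl
  preimage-list {f = f} ((x , refl) ∷ images) =
    let xs , eq = preimage-list images in x ∷ xs , cong (f x ∷_) eq

  grid : (ℕ → ℕ → A) → ℕ → ℕ → List A
  grid g K L = cartesianProductWith g (upTo K) (upTo L)

  pairsBelow : (ℕ → ℕ → A) → ℕ → List A
  pairsBelow g zero    = []
  pairsBelow g (suc n) = map (λ i → g i n) (upTo n) ++ pairsBelow g n

  Injective₂ : (ℕ → ℕ → A) → Set
  Injective₂ g = ∀ {i j i′ j′} → g i j ≡ g i′ j′ → i ≡ i′ × j ≡ j′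

  length-grid : ∀ g K L → length (grid g K L) ≡ K * L
  length-grid g K L = trans (go (upTo K)) (cong₂ _*_ (length-upTo K) (length-upTo L))
    where
    go : ∀ is → length (cartesianProductWith g is (upTo L)) ≡ length is * length (upTo L)
    go []       = refl
    go (i ∷ is) = trans (length-++ (map (g i) (upTo L)))
                        (cong₂ _+_ (length-map (g i) (upTo L)) (go is))

  ∈-grid⁻ : ∀ g K L {x} → x ∈ grid g K L → ∃₂ λ i j → i < K × j < L × x ≡ g i j
  ∈-grid⁻ g K L x∈ =
    let i , j , i∈ , j∈ , eq = ∈-cartesianProductWith⁻ g (upTo K) (upTo L) x∈
    in i , j , ∈-upTo⁻ i∈ , ∈-upTo⁻ j∈ , eq

  grid-unique : ∀ {g} K L → Injective₂ g → Unique (grid g K L)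
  grid-unique {g} K L inj = Unique.cartesianProductWith⁺ g inj (Unique.upTo⁺ K) (Unique.upTo⁺ L)

  length-pairsBelow : ∀ g n → length (pairsBelow g n) ≡ n C 2
  length-pairsBelow g zero    = refl
  length-pairsBelow g (suc n) = begin
    length (map (λ i → g i n) (upTo n) ++ pairsBelow g n)   ≡⟨ length-++ (map (λ i → g i n) (upTo n)) ⟩
    length (map (λ i → g i n) (upTo n)) + length (pairsBelow g n)
      ≡⟨ cong₂ _+_ (trans (length-map _ (upTo n)) (length-upTo n)) (length-pairsBelow g n) ⟩
    n + n C 2                                               ≡⟨ +-comm n (n C 2) ⟩
    n C 2 + n                                               ≡⟨ suc-C2 n ⟨
    suc n C 2                                               ∎
    where open ≡-Reasoning

  ∈-pairsBelow⁻ : ∀ g n {x} → x ∈ pairsBelow g n → ∃₂ λ i j → i < j × j < n × x ≡ g i j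
  ∈-pairsBelow⁻ g (suc n) x∈ with ∈-++⁻ (map (λ i → g i n) (upTo n)) x∈
  ... | inj₁ x∈row = let i , i∈ , eq = ∈-map⁻ (λ i → g i n) x∈row
                     in i , n , ∈-upTo⁻ i∈ , n<1+n n , eq
  ... | inj₂ x∈rest = let i , j , i<j , j<n , eq = ∈-pairsBelow⁻ g n x∈rest
                      in i , j , i<j , m<n⇒m<1+n j<n , eq

  pairsBelow-unique : ∀ {g} n → Injective₂ g → Unique (pairsBelow g n)
  pairsBelow-unique zero    inj = []
  pairsBelow-unique {g} (suc n) inj =
    Unique.++⁺ (Unique.map⁺ (proj₁ ∘ inj) (Unique.upTo⁺ n)) (pairsBelow-unique n inj) disjoint
    where
    disjoint : ∀ {x} → ¬ (x ∈ map (λ i → g i n) (upTo n) × x ∈ pairsBelow g n)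
    disjoint (x∈row , x∈rest) =
      let _ , _ , eq = ∈-map⁻ (λ i → g i n) x∈row
          _ , _ , _ , j<n , eq′ = ∈-pairsBelow⁻ g n x∈rest
      in <-irrefl (proj₂ (inj (trans (sym eq′) eq))) j<n

  all-grid : ∀ {P : A → Set} g K L → (∀ {i j} → i < K → j < L → P (g i j)) → All P (grid g K L)
  all-grid {P} g K L P-g = All.tabulate λ x∈ →
    let _ , _ , i<K , j<L , eq = ∈-grid⁻ g K L x∈ in subst P (sym eq) (P-g i<K j<L)

  all-pairsBelow : ∀ {P : A → Set} g n → (∀ {i j} → i < j → j < n → P (g i j)) → All P (pairsBelow g n)
  all-pairsBelow {P} g n P-g = All.tabulate λ x∈ →
    let _ , _ , i<j , j<n , eq = ∈-pairsBelow⁻ g n x∈ in subst P (sym eq) (P-g i<j j<n)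

  unique-constant⇒length≤1 : ∀ {a : A} {xs} → Unique xs → All (_≡ a) xs → length xs ≤ 1
  unique-constant⇒length≤1 {xs = []}        _               _                 = z≤n
  unique-constant⇒length≤1 {xs = _ ∷ []}    _               _                 = s≤s z≤n
  unique-constant⇒length≤1 {xs = _ ∷ _ ∷ _} ((x≢y ∷ _) ∷ _) (x≡a ∷ y≡a ∷ _) =
    contradiction (trans x≡a (sym y≡a)) x≢y

unique-bounded⇒length≤ : ∀ Δ {ns : List ℕ} → Unique ns → All (_< Δ) ns → length ns ≤ Δ
unique-bounded⇒length≤ zero    {[]}    _ _        = z≤n
unique-bounded⇒length≤ zero    {_ ∷ _} _ (() ∷ _)
unique-bounded⇒length≤ (suc d) {ns} unique bounded = begin
  length ns                              ≡⟨ length-filter-split (_<? d) ns ⟩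
  length (filter (_<? d) ns) + length top
    ≤⟨ +-mono-≤ (unique-bounded⇒length≤ d (Unique.filter⁺ (_<? d) unique) (All.all-filter (_<? d) ns))
                (unique-constant⇒length≤1 (Unique.filter⁺ (¬? ∘ (_<? d)) unique) top≡d) ⟩
  d + 1                                  ≡⟨ +-comm d 1 ⟩
  suc d                                  ∎
  where
  open ≤-Reasoning
  top = filter (¬? ∘ (_<? d)) ns
  top≡d : All (_≡ d) top
  top≡d = All.tabulate λ k∈ → let k∈ns , k≮d = ∈-filter⁻ (¬? ∘ (_<? d)) {xs = ns} k∈
                              in ≤-antisym (m<1+n⇒m≤n (All.lookup bounded k∈ns)) (≮⇒≥ k≮d)

-- Unordered pairs and two-element subsets

_≐_ : ∀ {A : Set} → A × A → A × A → Set
p ≐ q = p ≡ q ⊎ p ≡ swap q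

≐-cong : ∀ {A B : Set} (f : A → B) {a b c d} → (a , b) ≐ (c , d) → (f a , f b) ≐ (f c , f d)
≐-cong f (inj₁ refl) = inj₁ refl
≐-cong f (inj₂ refl) = inj₂ refl

≐-pullback : ∀ {A B : Set} (f : A → B) {i j s x} → (f i , f j) ≐ (s , x) →
             ∃₂ λ a b → (i , j) ≐ (a , b) × f a ≡ s × f b ≡ x
≐-pullback f {i} {j} (inj₁ refl) = i , j , inj₁ refl , refl , refl
≐-pullback f {i} {j} (inj₂ refl) = j , i , inj₂ refl , refl , refl

≢-resp-≐ : ∀ {A : Set} {i j a b : A} → i ≢ j → (i , j) ≐ (a , b) → a ≢ b
≢-resp-≐ i≢j (inj₁ refl) = i≢j
≢-resp-≐ i≢j (inj₂ refl) = i≢j ∘ sym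

≐-sym : ∀ {A : Set} {a b c d : A} → (a , b) ≐ (c , d) → (c , d) ≐ (a , b)
≐-sym (inj₁ refl) = inj₁ refl
≐-sym (inj₂ refl) = inj₂ refl

≐-agree : ∀ {A : Set} {p : A × A} {a b c d} → p ≐ (a , b) → p ≐ (c , d) → (a , b) ≐ (c , d)
≐-agree (inj₁ refl) (inj₁ refl) = inj₁ refl
≐-agree (inj₁ refl) (inj₂ refl) = inj₂ refl
≐-agree (inj₂ refl) (inj₁ refl) = inj₂ refl
≐-agree (inj₂ refl) (inj₂ refl) = inj₁ refl

three-in-two : ∀ {A : Set} {a b c x y : A} → a ≢ b → a ≢ c → b ≢ c →
               a ≡ x ⊎ a ≡ y → b ≡ x ⊎ b ≡ y → c ≡ x ⊎ c ≡ y → ⊥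
three-in-two a≢b _   _   (inj₁ refl) (inj₁ refl) _           = a≢b refl
three-in-two a≢b _   _   (inj₂ refl) (inj₂ refl) _           = a≢b refl
three-in-two _   a≢c _   (inj₁ refl) (inj₂ refl) (inj₁ refl) = a≢c refl
three-in-two _   _   b≢c (inj₁ refl) (inj₂ refl) (inj₂ refl) = b≢c refl
three-in-two _   _   b≢c (inj₂ refl) (inj₁ refl) (inj₁ refl) = b≢c refl
three-in-two _   a≢c _   (inj₂ refl) (inj₁ refl) (inj₂ refl) = a≢c refl

pair : ∀ {N} → Fin N → Fin N → Subset N
pair i j = ⁅ i ⁆ ∪ ⁅ j ⁆

symdiff : ∀ {N} → Subset N → Subset N → Subset N
symdiff p q = (p ─ q) ∪ (q ─ p)

lookup-⁅⁆ : ∀ {N} (i t : Fin N) → lookup ⁅ i ⁆ t ≡ does (t Fin.≟ i)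
lookup-⁅⁆ zero    zero    = refl
lookup-⁅⁆ zero    (suc t) = lookup-replicate t false
lookup-⁅⁆ (suc i) zero    = refl
lookup-⁅⁆ (suc i) (suc t) = lookup-⁅⁆ i t

lookup-pair : ∀ {N} (i j t : Fin N) → lookup (pair i j) t ≡ does (t Fin.≟ i) ∨ does (t Fin.≟ j)
lookup-pair i j t = trans (lookup-zipWith _∨_ t ⁅ i ⁆ ⁅ j ⁆) (cong₂ _∨_ (lookup-⁅⁆ i t) (lookup-⁅⁆ j t))

lookup-symdiff : ∀ {N} (p q : Subset N) t → lookup (symdiff p q) t ≡ lookup p t xor lookup q t
lookup-symdiff (true  ∷ p) (true  ∷ q) zero    = refl
lookup-symdiff (true  ∷ p) (false ∷ q) zero    = refl
lookup-symdiff (false ∷ p) (true  ∷ q) zero    = refl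
lookup-symdiff (false ∷ p) (false ∷ q) zero    = refl
lookup-symdiff (_     ∷ p) (_     ∷ q) (suc t) = lookup-symdiff p q t

subset-ext : ∀ {N} {p q : Subset N} → (∀ t → lookup p t ≡ lookup q t) → p ≡ q
subset-ext {p = p} {q} p≗q = trans (sym (tabulate∘lookup p)) (trans (tabulate-cong p≗q) (tabulate∘lookup q))

pair-∋ˡ : ∀ {N} (i j : Fin N) → lookup (pair i j) i ≡ true
pair-∋ˡ i j = trans (lookup-pair i j i) (cong (_∨ does (i Fin.≟ j)) (dec-true (i Fin.≟ i) refl))

pair-∋ʳ : ∀ {N} (i j : Fin N) → lookup (pair i j) j ≡ true
pair-∋ʳ i j =
  trans (lookup-pair i j j) (trans (cong (does (j Fin.≟ i) ∨_) (dec-true (j Fin.≟ j) refl)) (∨-zeroʳ _))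

pair-∌ : ∀ {N} {i j t : Fin N} → t ≢ i → t ≢ j → lookup (pair i j) t ≡ false
pair-∌ {i = i} {j} {t} t≢i t≢j =
  trans (lookup-pair i j t) (cong₂ _∨_ (dec-false (t Fin.≟ i) t≢i) (dec-false (t Fin.≟ j) t≢j))

pair-∋⁻ : ∀ {N} {i j t : Fin N} → lookup (pair i j) t ≡ true → t ≡ i ⊎ t ≡ j
pair-∋⁻ {i = i} {j} {t} t∈ = decide (trans (sym (lookup-pair i j t)) t∈)
  where
  decide : does (t Fin.≟ i) ∨ does (t Fin.≟ j) ≡ true → t ≡ i ⊎ t ≡ j
  decide with t Fin.≟ i | t Fin.≟ j
  ... | yes t≡i | _       = λ _ → inj₁ t≡i
  ... | no _    | yes t≡j = λ _ → inj₂ t≡j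
  ... | no _    | no _    = λ ()

≐⇒pair≡ : ∀ {N} {i j k l : Fin N} → (i , j) ≐ (k , l) → pair i j ≡ pair k l
≐⇒pair≡ (inj₁ refl) = refl
≐⇒pair≡ (inj₂ refl) = ∪-comm _ _

pair-injective : ∀ {N} {i j k l : Fin N} → i ≢ j → pair i j ≡ pair k l → (i , j) ≐ (k , l)
pair-injective {i = i} {j} {k} {l} i≢j eq
  with pair-∋⁻ {i = k} {l} (subst (λ s → lookup s i ≡ true) eq (pair-∋ˡ i j))
     | pair-∋⁻ {i = k} {l} (subst (λ s → lookup s j ≡ true) eq (pair-∋ʳ i j))
... | inj₁ refl | inj₁ refl = contradiction refl i≢j
... | inj₁ refl | inj₂ refl = inj₁ refl
... | inj₂ refl | inj₁ refl = inj₂ refl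
... | inj₂ refl | inj₂ refl = contradiction refl i≢j

∣pair∣≡2 : ∀ {N} {i j : Fin N} → i ≢ j → ∣ pair i j ∣ ≡ 2
∣pair∣≡2 {i = zero}  {zero}  i≢j = contradiction refl i≢j
∣pair∣≡2 {i = zero}  {suc j} _   = cong suc (trans (cong ∣_∣ (∪-identityˡ ⁅ j ⁆)) (∣⁅x⁆∣≡1 j))
∣pair∣≡2 {i = suc i} {zero}  _   = cong suc (trans (cong ∣_∣ (∪-identityʳ ⁅ i ⁆)) (∣⁅x⁆∣≡1 i))
∣pair∣≡2 {i = suc i} {suc j} i≢j = ∣pair∣≡2 (i≢j ∘ cong suc)

∣p∣≡0⇒p≡∅ : ∀ {N} (p : Subset N) → ∣ p ∣ ≡ 0 → p ≡ ∅
∣p∣≡0⇒p≡∅ []          _  = refl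
∣p∣≡0⇒p≡∅ (false ∷ p) eq = cong (false ∷_) (∣p∣≡0⇒p≡∅ p eq)

∣p∣≡1⇒p≡⁅i⁆ : ∀ {N} (p : Subset N) → ∣ p ∣ ≡ 1 → ∃[ i ] p ≡ ⁅ i ⁆
∣p∣≡1⇒p≡⁅i⁆ (true  ∷ p) eq = zero , cong (true ∷_) (∣p∣≡0⇒p≡∅ p (suc-injective eq))
∣p∣≡1⇒p≡⁅i⁆ (false ∷ p) eq = let i , p≡⁅i⁆ = ∣p∣≡1⇒p≡⁅i⁆ p eq in suc i , cong (false ∷_) p≡⁅i⁆

∣p∣≡2⇒p≡pair : ∀ {N} (p : Subset N) → ∣ p ∣ ≡ 2 → ∃₂ λ i j → toℕ i < toℕ j × p ≡ pair i j
∣p∣≡2⇒p≡pair (true ∷ p) eq =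
  let j , p≡⁅j⁆ = ∣p∣≡1⇒p≡⁅i⁆ p (suc-injective eq)
  in zero , suc j , s≤s z≤n , cong (true ∷_) (trans p≡⁅j⁆ (sym (∪-identityˡ ⁅ j ⁆)))
∣p∣≡2⇒p≡pair (false ∷ p) eq =
  let i , j , i<j , p≡pair = ∣p∣≡2⇒p≡pair p eq in suc i , suc j , s≤s i<j , cong (false ∷_) p≡pair

symdiff-pair-pair : ∀ {N} {s x y : Fin N} → s ≢ x → s ≢ y → x ≢ y →
                    symdiff (pair s x) (pair s y) ≡ pair x y
symdiff-pair-pair {s = s} {x} {y} s≢x s≢y x≢y = subset-ext λ t → begin
  lookup (symdiff (pair s x) (pair s y)) t
    ≡⟨ lookup-symdiff (pair s x) (pair s y) t ⟩
  lookup (pair s x) t xor lookup (pair s y) t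
    ≡⟨ cong₂ _xor_ (lookup-pair s x t) (lookup-pair s y t) ⟩
  (does (t Fin.≟ s) ∨ does (t Fin.≟ x)) xor (does (t Fin.≟ s) ∨ does (t Fin.≟ y))
    ≡⟨ pointwise t ⟩
  does (t Fin.≟ x) ∨ does (t Fin.≟ y)
    ≡⟨ lookup-pair x y t ⟨
  lookup (pair x y) t
    ∎
  where
  open ≡-Reasoning
  pointwise : ∀ t → (does (t Fin.≟ s) ∨ does (t Fin.≟ x)) xor (does (t Fin.≟ s) ∨ does (t Fin.≟ y))
                    ≡ does (t Fin.≟ x) ∨ does (t Fin.≟ y)
  pointwise t with t Fin.≟ s | t Fin.≟ x | t Fin.≟ y
  ... | yes refl | yes refl | _        = contradiction refl s≢x
  ... | yes refl | _        | yes refl = contradiction refl s≢y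
  ... | _        | yes refl | yes refl = contradiction refl x≢y
  ... | yes _    | no _     | no _     = refl
  ... | no _     | yes _    | no _     = refl
  ... | no _     | no _     | yes _    = refl
  ... | no _     | no _     | no _     = refl

-- Were {i, j} and {k, l} equal or disjoint, their symmetric difference would have 0 or 4 elements.
symdiff≡pair⇒shared : ∀ {N} {i j k l x y : Fin N} → i ≢ j → k ≢ l → x ≢ y →
  symdiff (pair i j) (pair k l) ≡ pair x y →
  ∃[ a ] ∃[ b ] ∃[ c ] ((i , j) ≐ (a , b) × (k , l) ≐ (a , c) × (x , y) ≐ (b , c))
symdiff≡pair⇒shared {i = i} {j} {k} {l} {x} {y} i≢j k≢l x≢y eq =
  cases (i Fin.≟ k) (j Fin.≟ l) (i Fin.≟ l) (j Fin.≟ k)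
  where
  open ≡-Reasoning
  Shared : Set
  Shared = ∃[ a ] ∃[ b ] ∃[ c ] ((i , j) ≐ (a , b) × (k , l) ≐ (a , c) × (x , y) ≐ (b , c))

  shared : ∀ {a b c} → (i , j) ≐ (a , b) → (k , l) ≐ (a , c) → b ≢ c → Shared
  shared {a} {b} {c} ij≐ab kl≐ac b≢c = a , b , c , ij≐ab , kl≐ac , ≐-sym (pair-injective b≢c (begin
    pair b c                        ≡⟨ symdiff-pair-pair (≢-resp-≐ i≢j ij≐ab) (≢-resp-≐ k≢l kl≐ac) b≢c ⟨
    symdiff (pair a b) (pair a c)   ≡⟨ cong₂ symdiff (≐⇒pair≡ ij≐ab) (≐⇒pair≡ kl≐ac) ⟨
    symdiff (pair i j) (pair k l)   ≡⟨ eq ⟩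
    pair x y                        ∎))

  not-both : pair i j ≡ pair k l → ⊥
  not-both same with () ← begin
    true                                       ≡⟨ pair-∋ˡ x y ⟨
    lookup (pair x y) x                        ≡⟨ cong (λ s → lookup s x) eq ⟨
    lookup (symdiff (pair i j) (pair k l)) x   ≡⟨ cong (λ s → lookup (symdiff (pair i j) s) x) same ⟨
    lookup (symdiff (pair i j) (pair i j)) x   ≡⟨ lookup-symdiff (pair i j) (pair i j) x ⟩
    lookup (pair i j) x xor lookup (pair i j) x ≡⟨ xor-same (lookup (pair i j) x) ⟩
    false                                      ∎

  member : ∀ t → lookup (pair i j) t xor lookup (pair k l) t ≡ true → t ≡ x ⊎ t ≡ y
  member t t∈ =
    pair-∋⁻ (trans (cong (λ s → lookup s t) (sym eq)) (trans (lookup-symdiff (pair i j) (pair k l) t) t∈))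

  cases : Dec (i ≡ k) → Dec (j ≡ l) → Dec (i ≡ l) → Dec (j ≡ k) → Shared
  cases (yes refl) (yes refl) _          _          = ⊥-elim (not-both refl)
  cases (yes refl) (no j≢l)   _          _          = shared (inj₁ refl) (inj₁ refl) j≢l
  cases (no i≢k)   (yes refl) _          _          = shared (inj₂ refl) (inj₂ refl) i≢k
  cases (no _)     (no _)     (yes refl) (yes refl) = ⊥-elim (not-both (∪-comm ⁅ i ⁆ ⁅ j ⁆))
  cases (no _)     (no _)     (yes refl) (no j≢k)   = shared (inj₁ refl) (inj₂ refl) j≢k
  cases (no _)     (no _)     (no i≢l)   (yes refl) = shared (inj₂ refl) (inj₁ refl) i≢l
  cases (no i≢k)   (no j≢l)   (no i≢l)   (no j≢k)   = ⊥-elim (three-in-two i≢j i≢k j≢k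
    (member i (cong₂ _xor_ (pair-∋ˡ i j) (pair-∌ i≢k i≢l)))
    (member j (cong₂ _xor_ (pair-∋ʳ i j) (pair-∌ j≢k j≢l)))
    (member k (cong₂ _xor_ (pair-∌ (i≢k ∘ sym) (j≢k ∘ sym)) (pair-∋ˡ k l))))

-- The vertices of E_n + P_m for all n and m at once; InRange n m cuts out F n m.
data Vertex : Set where
  edgeless path : ℕ → Vertex

infix 4 _~_ _≺_

_~_ : Vertex → Vertex → Set
edgeless _ ~ edgeless _ = ⊥
edgeless _ ~ path _     = ⊤
path _     ~ edgeless _ = ⊤
path i     ~ path j     = suc i ≡ j ⊎ suc j ≡ i

~-sym : ∀ {x y} → x ~ y → y ~ x
~-sym {edgeless _} {path _}     _ = tt
~-sym {path _}     {edgeless _} _ = tt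
~-sym {path _}     {path _}       = Sum.swap

~-irrefl : ∀ {x} → ¬ x ~ x
~-irrefl {path _} (inj₁ eq) = 1+n≢n eq
~-irrefl {path _} (inj₂ eq) = 1+n≢n eq

~-resp-≐ : ∀ {x y b c} → x ~ y → (x , y) ≐ (b , c) → b ~ c
~-resp-≐ x~y (inj₁ refl) = x~y
~-resp-≐ x~y (inj₂ refl) = ~-sym x~y

_≺_ : Vertex → Vertex → Set
edgeless i ≺ edgeless j = i < j
edgeless _ ≺ path _     = ⊤
path _     ≺ edgeless _ = ⊥
path i     ≺ path j     = i < j

≺-irrefl : ∀ {u} → ¬ u ≺ u
≺-irrefl {edgeless _} = <-irrefl refl
≺-irrefl {path _}     = <-irrefl refl

≺-asym : ∀ {u v} → u ≺ v → ¬ v ≺ u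
≺-asym {edgeless _} {edgeless _} = <-asym
≺-asym {path _}     {path _}     = <-asym

InRange : ℕ → ℕ → Vertex → Set
InRange n m (edgeless i) = i < n
InRange n m (path j)     = j < m

inRange? : ∀ n m v → Dec (InRange n m v)
inRange? n m (edgeless i) = i <? n
inRange? n m (path j)     = j <? m

position : ℕ → Vertex → ℕ
position n (edgeless i) = i
position n (path j)     = n + j

position< : ∀ {n m v} → InRange n m v → position n v < n + m
position< {n} {m} {edgeless i} i<n = <-≤-trans i<n (m≤m+n n m)
position< {n} {v = path j} j<m = +-monoʳ-< n j<m

position-injective : ∀ {n m x y} → InRange n m x → InRange n m y → position n x ≡ position n y → x ≡ y
position-injective {n} {x = edgeless i} {edgeless j} _   _   eq = cong edgeless eq
position-injective {n} {x = edgeless i} {path j}     i<n _   eq =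
  contradiction eq (<⇒≢ (<-≤-trans i<n (m≤m+n n j)))
position-injective {n} {x = path i}     {edgeless j} _   j<n eq =
  contradiction (sym eq) (<⇒≢ (<-≤-trans j<n (m≤m+n n i)))
position-injective {n} {x = path i}     {path j}     _   _   eq = cong path (+-cancelˡ-≡ n i j eq)

position-<⇒≺ : ∀ {n m u v} → InRange n m v → position n u < position n v → u ≺ v
position-<⇒≺ {u = edgeless _} {edgeless _} _   lt = lt
position-<⇒≺ {u = edgeless _} {path _}     _   _  = tt
position-<⇒≺ {n} {u = path i} {edgeless j} j<n lt = <-asym lt (<-≤-trans j<n (m≤m+n n i))
position-<⇒≺ {n} {u = path _} {path _}     _   lt = +-cancelˡ-< n _ _ lt

≺⇒position-< : ∀ {n m u v} → InRange n m u → u ≺ v → position n u < position n v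
≺⇒position-< {u = edgeless _} {edgeless _} _   lt = lt
≺⇒position-< {n} {u = edgeless _} {path j} i<n _ = <-≤-trans i<n (m≤m+n n j)
≺⇒position-< {n} {u = path _} {path _}     _   lt = +-monoʳ-< n lt

Pair : Set
Pair = Vertex × Vertex

-- A token {u, v} is represented by the pair (u , v) with u ≺ v.
Ordered : Pair → Set
Ordered (u , v) = u ≺ v

Inside : ℕ → ℕ → Pair → Set
Inside n m (u , v) = InRange n m u × InRange n m v

inside? : ∀ n m → Decidable (Inside n m)
inside? n m (u , v) = inRange? n m u ×-dec inRange? n m v

Token : ℕ → ℕ → Pair → Set
Token n m p = Ordered p × Inside n m p

TokenAdj : Pair → Pair → Set
TokenAdj p q = ∃[ s ] ∃[ x ] ∃[ y ] (p ≐ (s , x) × q ≐ (s , y) × x ~ y)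

Independent : List Pair → Set
Independent S = ∀ {p q} → p ∈ S → q ∈ S → ¬ TokenAdj p q

≐-ordered : ∀ {p q r} → Ordered p → Ordered q → p ≐ r → q ≐ r → p ≡ q
≐-ordered _  _  (inj₁ refl) (inj₁ refl) = refl
≐-ordered _  _  (inj₂ refl) (inj₂ refl) = refl
≐-ordered op oq (inj₁ refl) (inj₂ refl) = contradiction op (≺-asym oq)
≐-ordered op oq (inj₂ refl) (inj₁ refl) = contradiction op (≺-asym oq)

throughCommonVertex : ∀ {p q s x y} → Ordered p → Ordered q → p ≐ (s , x) → q ≐ (s , y) →
                      x ≡ y ⊎ x ~ y → p ≡ q ⊎ TokenAdj p q
throughCommonVertex op oq p≐sx q≐sy (inj₁ refl) = inj₁ (≐-ordered op oq p≐sx q≐sy)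
throughCommonVertex {s = s} {x} {y} _ _ p≐sx q≐sy (inj₂ x~y) = inj₂ (s , x , y , p≐sx , q≐sy , x~y)

-- Upper bound

IndependenceBound : ℕ → ℕ → ℕ → Set
IndependenceBound n m t = ∀ S → All (Token n m) S → Unique S → Independent S → length S ≤ t

noTokens : IndependenceBound 0 0 0
noTokens []                   _                    _ _ = z≤n
noTokens ((edgeless _ , _) ∷ _) ((_ , () , _) ∷ _) _ _
noTokens ((path _ , _)     ∷ _) ((_ , () , _) ∷ _) _ _

record NewTokenCliqueCover (n m n′ m′ Δ : ℕ) : Set where
  field
    clique     : Pair → ℕ
    clique<    : ∀ {p} → Token n m p → ¬ Inside n′ m′ p → clique p < Δ
    sameClique : ∀ {p q} → Token n m p → Token n m q → ¬ Inside n′ m′ p → ¬ Inside n′ m′ q →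
                 clique p ≡ clique q → p ≡ q ⊎ TokenAdj p q

extend : ∀ {n m n′ m′ Δ t} → NewTokenCliqueCover n m n′ m′ Δ →
         IndependenceBound n′ m′ t → IndependenceBound n m (t + Δ)
extend {n′ = n′} {m′} {Δ} {t} cover bound S tokens unique independent = begin
  length S                 ≡⟨ length-filter-split (inside? n′ m′) S ⟩
  length old + length new  ≤⟨ +-mono-≤ old-bound new-bound ⟩
  t + Δ                    ∎
  where
  open ≤-Reasoning
  open NewTokenCliqueCover cover
  old = filter (inside? n′ m′) S
  new = filter (¬? ∘ inside? n′ m′) S

  ∈old⁻ : ∀ {p} → p ∈ old → p ∈ S × Inside n′ m′ p
  ∈old⁻ = ∈-filter⁻ (inside? n′ m′) {xs = S}

  ∈new⁻ : ∀ {p} → p ∈ new → p ∈ S × ¬ Inside n′ m′ p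
  ∈new⁻ = ∈-filter⁻ (¬? ∘ inside? n′ m′) {xs = S}

  old-bound : length old ≤ t
  old-bound = bound old
    (All.tabulate λ p∈ → let p∈S , p-old = ∈old⁻ p∈ in proj₁ (All.lookup tokens p∈S) , p-old)
    (Unique.filter⁺ (inside? n′ m′) unique)
    (λ p∈ q∈ → independent (proj₁ (∈old⁻ p∈)) (proj₁ (∈old⁻ q∈)))

  clique-injective : ∀ {p q} → p ∈ new → q ∈ new → clique p ≡ clique q → p ≡ q
  clique-injective p∈ q∈ eq with ∈new⁻ p∈ | ∈new⁻ q∈
  ... | p∈S , p-new | q∈S , q-new
    with sameClique (All.lookup tokens p∈S) (All.lookup tokens q∈S) p-new q-new eq
  ...   | inj₁ p≡q = p≡q
  ...   | inj₂ adj = contradiction adj (independent p∈S q∈S)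

  new-bound : length new ≤ Δ
  new-bound = begin
    length new               ≡⟨ length-map clique new ⟨
    length (map clique new)  ≤⟨ unique-bounded⇒length≤ Δ
                                  (map⁺-injectiveOn clique-injective (Unique.filter⁺ (¬? ∘ inside? n′ m′) unique))
                                  (All.map⁺ (All.tabulate λ p∈ →
                                    let p∈S , p-new = ∈new⁻ p∈ in clique< (All.lookup tokens p∈S) p-new)) ⟩
    Δ                        ∎

cliqueIndex : Vertex → ℕ
cliqueIndex (edgeless i) = i
cliqueIndex (path j)     = ⌊ j /2⌋

cliqueIndex< : ∀ {n m x} → InRange n m x → cliqueIndex x < n ⊔ ⌈ m /2⌉
cliqueIndex< {n} {m} {edgeless _} i<n = <-≤-trans i<n (m≤m⊔n n ⌈ m /2⌉)
cliqueIndex< {n} {m} {path _}     j<m = <-≤-trans (⌈n/2⌉-mono j<m) (m≤n⊔m n ⌈ m /2⌉)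

⌊i/2⌋≡⌊j/2⌋⇒i≡j∨|i-j|≡1 : ∀ i j → ⌊ i /2⌋ ≡ ⌊ j /2⌋ → i ≡ j ⊎ (suc i ≡ j ⊎ suc j ≡ i)
⌊i/2⌋≡⌊j/2⌋⇒i≡j∨|i-j|≡1 0             0             _  = inj₁ refl
⌊i/2⌋≡⌊j/2⌋⇒i≡j∨|i-j|≡1 0             1             _  = inj₂ (inj₁ refl)
⌊i/2⌋≡⌊j/2⌋⇒i≡j∨|i-j|≡1 1             0             _  = inj₂ (inj₂ refl)
⌊i/2⌋≡⌊j/2⌋⇒i≡j∨|i-j|≡1 1             1             _  = inj₁ refl
⌊i/2⌋≡⌊j/2⌋⇒i≡j∨|i-j|≡1 (suc (suc i)) (suc (suc j)) eq =
  Sum.map (cong (2 +_)) (Sum.map (cong (2 +_)) (cong (2 +_))) (⌊i/2⌋≡⌊j/2⌋⇒i≡j∨|i-j|≡1 i j (suc-injective eq))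

sameCliqueIndex : ∀ {x y} → cliqueIndex x ≡ cliqueIndex y → x ≡ y ⊎ x ~ y
sameCliqueIndex {edgeless _} {edgeless _} eq = inj₁ (cong edgeless eq)
sameCliqueIndex {edgeless _} {path _}     _  = inj₂ tt
sameCliqueIndex {path _}     {edgeless _} _  = inj₂ tt
sameCliqueIndex {path i}     {path j}     eq = Sum.map₁ (cong path) (⌊i/2⌋≡⌊j/2⌋⇒i≡j∨|i-j|≡1 i j eq)

module _ {n m n′ m′ : ℕ} (v₀ : Vertex) (only-v₀ : ∀ {w} → InRange n m w → ¬ InRange n′ m′ w → w ≡ v₀) where

  keptEnd : Pair → Vertex
  keptEnd (u , v) = if does (inRange? n′ m′ u) then u else v

  keptEnd-spec : ∀ {p} → Token n m p → ¬ Inside n′ m′ p → p ≐ (v₀ , keptEnd p) × InRange n′ m′ (keptEnd p)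
  keptEnd-spec {u , v} (u≺v , u∈ , v∈) new with inRange? n′ m′ u | inRange? n′ m′ v
  ... | yes u∈′ | yes v∈′ = contradiction (u∈′ , v∈′) new
  ... | yes u∈′ | no v∉′  = inj₂ (cong (u ,_) (only-v₀ v∈ v∉′)) , u∈′
  ... | no u∉′  | yes v∈′ = inj₁ (cong (_, v) (only-v₀ u∈ u∉′)) , v∈′
  ... | no u∉′  | no v∉′  =
    contradiction (subst (u ≺_) (trans (only-v₀ v∈ v∉′) (sym (only-v₀ u∈ u∉′))) u≺v) ≺-irrefl

  newVertexCover : NewTokenCliqueCover n m n′ m′ (n′ ⊔ ⌈ m′ /2⌉)
  newVertexCover = record
    { clique     = cliqueIndex ∘ keptEnd
    ; clique<    = λ tp p-new → cliqueIndex< (proj₂ (keptEnd-spec tp p-new))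
    ; sameClique = λ tp tq p-new q-new eq →
        throughCommonVertex (proj₁ tp) (proj₁ tq)
          (proj₁ (keptEnd-spec tp p-new)) (proj₁ (keptEnd-spec tq q-new)) (sameCliqueIndex eq)
    }

addEdgeless : ∀ {n m t} → IndependenceBound n m t → IndependenceBound (suc n) m (t + (n ⊔ ⌈ m /2⌉))
addEdgeless {n} = extend (newVertexCover (edgeless n) new)
  where
  new : ∀ {m w} → InRange (suc n) m w → ¬ InRange n m w → w ≡ edgeless n
  new {w = edgeless i} i<1+n i≮n = [ flip contradiction i≮n , cong edgeless ]′ (m<1+n⇒m<n∨m≡n i<1+n)
  new {w = path _}     j<m   j≮m = contradiction j<m j≮m

addPathVertex : ∀ {n m t} → IndependenceBound n m t → IndependenceBound n (suc m) (t + (n ⊔ ⌈ m /2⌉))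
addPathVertex {n} {m} = extend (newVertexCover (path m) new)
  where
  new : ∀ {w} → InRange n (suc m) w → ¬ InRange n m w → w ≡ path m
  new {edgeless _} i<n   i≮n = contradiction i<n i≮n
  new {path j}     j<1+m j≮m = [ flip contradiction j≮m , cong path ]′ (m<1+n⇒m<n∨m≡n j<1+m)

data Corner (n m : ℕ) : Vertex → Set where
  top   : Corner n m (edgeless n)
  left  : Corner n m (path m)
  right : Corner n m (path (suc m))

corner? : ∀ n m w → Dec (Corner n m w)
corner? n m (edgeless i) with i ≟ n
... | yes refl = yes top
... | no i≢n   = no λ { top → i≢n refl }
corner? n m (path j) with j ≟ m | j ≟ suc m
... | yes refl | _        = yes left
... | no _     | yes refl = yes right
... | no j≢m   | no j≢1+m = no λ { left → j≢m refl ; right → j≢1+m refl }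

corners-adjacent : ∀ {n m t t′} → Corner n m t → Corner n m t′ → t ≡ t′ ⊎ t ~ t′
corners-adjacent top   top   = inj₁ refl
corners-adjacent top   left  = inj₂ tt
corners-adjacent top   right = inj₂ tt
corners-adjacent left  top   = inj₂ tt
corners-adjacent left  left  = inj₁ refl
corners-adjacent left  right = inj₂ (inj₁ refl)
corners-adjacent right top   = inj₂ tt
corners-adjacent right left  = inj₂ (inj₂ refl)
corners-adjacent right right = inj₁ refl

newCorner : ∀ {n m w} → InRange (suc n) (suc (suc m)) w → ¬ InRange n m w → Corner n m w
newCorner {w = edgeless _} i<1+n i≮n with m<1+n⇒m<n∨m≡n i<1+n
... | inj₁ i<n  = contradiction i<n i≮n
... | inj₂ refl = top
newCorner {w = path _} j<2+m j≮m with m<1+n⇒m<n∨m≡n j<2+m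
... | inj₂ refl = right
... | inj₁ j<1+m with m<1+n⇒m<n∨m≡n j<1+m
...   | inj₁ j<m  = contradiction j<m j≮m
...   | inj₂ refl = left

oldUnlessCorner : ∀ {n m w} → InRange (suc n) (suc (suc m)) w → ¬ Corner n m w → InRange n m w
oldUnlessCorner {n} {m} {w} w∈ not-corner with inRange? n m w
... | yes w∈′ = w∈′
... | no w∉′  = contradiction (newCorner w∈ w∉′) not-corner

triangleClique : ℕ → ℕ → Pair → ℕ
triangleClique n m (u , v) with corner? n m u | corner? n m v
... | yes _ | yes _ = n + m
... | yes _ | no _  = position n v
... | no _  | _     = position n u

data InnerToken (n m : ℕ) : Pair → Set where
  top-left   : InnerToken n m (edgeless n , path m)
  top-right  : InnerToken n m (edgeless n , path (suc m))
  left-right : InnerToken n m (path m , path (suc m))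

data TriangleToken (n m : ℕ) (p : Pair) : ℕ → Set where
  inner : InnerToken n m p → TriangleToken n m p (n + m)
  outer : ∀ {t x} → Corner n m t → InRange n m x → p ≐ (t , x) → TriangleToken n m p (position n x)

innerToken : ∀ {n m u v} → Corner n m u → Corner n m v → u ≺ v → InnerToken n m (u , v)
innerToken top   top   n<n     = contradiction n<n (<-irrefl refl)
innerToken top   left  _       = top-left
innerToken top   right _       = top-right
innerToken left  left  m<m     = contradiction m<m (<-irrefl refl)
innerToken left  right _       = left-right
innerToken right left  1+m<m   = contradiction 1+m<m (<-asym (n<1+n _))
innerToken right right 1+m<1+m = contradiction 1+m<1+m (<-irrefl refl)

innerTokens-adjacent : ∀ {n m p q} → InnerToken n m p → InnerToken n m q → p ≡ q ⊎ TokenAdj p q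
innerTokens-adjacent top-left   top-left   = inj₁ refl
innerTokens-adjacent top-right  top-right  = inj₁ refl
innerTokens-adjacent left-right left-right = inj₁ refl
innerTokens-adjacent top-left   top-right  = inj₂ (_ , _ , _ , inj₁ refl , inj₁ refl , inj₁ refl)
innerTokens-adjacent top-left   left-right = inj₂ (_ , _ , _ , inj₂ refl , inj₁ refl , tt)
innerTokens-adjacent top-right  top-left   = inj₂ (_ , _ , _ , inj₁ refl , inj₁ refl , inj₂ refl)
innerTokens-adjacent top-right  left-right = inj₂ (_ , _ , _ , inj₂ refl , inj₂ refl , tt)
innerTokens-adjacent left-right top-left   = inj₂ (_ , _ , _ , inj₁ refl , inj₂ refl , tt)
innerTokens-adjacent left-right top-right  = inj₂ (_ , _ , _ , inj₂ refl , inj₂ refl , tt)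

classifyTriangle : ∀ {n m} p → Token (suc n) (suc (suc m)) p → ¬ Inside n m p →
                   TriangleToken n m p (triangleClique n m p)
classifyTriangle {n} {m} (u , v) (u≺v , u∈ , v∈) new with corner? n m u | corner? n m v
... | yes cu | yes cv = inner (innerToken cu cv u≺v)
... | yes cu | no ¬cv = outer cu (oldUnlessCorner v∈ ¬cv) (inj₁ refl)
... | no ¬cu | _ with inRange? n m v
...   | yes v∈′ = contradiction (oldUnlessCorner u∈ ¬cu , v∈′) new
...   | no v∉′  = outer (newCorner v∈ v∉′) (oldUnlessCorner u∈ ¬cu) (inj₂ refl)

triangleCover : ∀ {n m} → NewTokenCliqueCover (suc n) (suc (suc m)) n m (suc (n + m))
triangleCover {n} {m} = record
  { clique     = triangleClique n m
  ; clique<    = λ {p} tp p-new → bounded (classifyTriangle p tp p-new)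
  ; sameClique = λ {p} {q} tp tq p-new q-new →
      compare (proj₁ tp) (proj₁ tq) (classifyTriangle p tp p-new) (classifyTriangle q tq q-new)
  }
  where
  bounded : ∀ {p k} → TriangleToken n m p k → k < suc (n + m)
  bounded (inner _)      = n<1+n (n + m)
  bounded (outer _ x∈ _) = m<n⇒m<1+n (position< x∈)

  compare : ∀ {p q k k′} → Ordered p → Ordered q → TriangleToken n m p k → TriangleToken n m q k′ →
            k ≡ k′ → p ≡ q ⊎ TokenAdj p q
  compare _  _  (inner ip)     (inner iq)     _  = innerTokens-adjacent ip iq
  compare _  _  (inner _)      (outer _ y∈ _) eq = contradiction (position< y∈) (<-irrefl (sym eq))
  compare _  _  (outer _ x∈ _) (inner _)      eq = contradiction (position< x∈) (<-irrefl eq)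
  compare op oq (outer ct x∈ p≐tx) (outer ct′ y∈ q≐t′y) eq with refl ← position-injective x∈ y∈ eq =
    throughCommonVertex op oq (Sum.swap p≐tx) (Sum.swap q≐t′y) (corners-adjacent ct ct′)

addTriangle : ∀ {n m t} → IndependenceBound n m t → IndependenceBound (suc n) (suc (suc m)) (t + suc (n + m))
addTriangle = extend triangleCover

-- F₂(E₃ + P₁) is a hexagon. Adding a vertex to E₂ + P₁ only gives the bound 4, but the
-- hexagon is covered by the three disjoint edges below.
data StarToken : ℕ → Pair → Set where
  spoke : ∀ {k} → StarToken k (edgeless k , path 0)
  rim₀₁ : StarToken 0 (edgeless 0 , edgeless 1)
  rim₁₂ : StarToken 1 (edgeless 1 , edgeless 2)
  rim₀₂ : StarToken 2 (edgeless 0 , edgeless 2)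

starClique : Pair → ℕ
starClique (edgeless i , path _)     = i
starClique (edgeless 0 , edgeless 2) = 2
starClique (edgeless i , edgeless _) = i
starClique (path _     , _)          = 0

classifyStar : ∀ p → Token 3 1 p → StarToken (starClique p) p
classifyStar (edgeless _ , path 0)       _ = spoke
classifyStar (edgeless _ , path (suc _)) (_ , _ , s≤s ())
classifyStar (edgeless 0 , edgeless 1)   _ = rim₀₁
classifyStar (edgeless 1 , edgeless 2)   _ = rim₁₂
classifyStar (edgeless 0 , edgeless 2)   _ = rim₀₂
classifyStar (edgeless 0 , edgeless 0)   (() , _)
classifyStar (edgeless 1 , edgeless 0)   (() , _)
classifyStar (edgeless 1 , edgeless 1)   (s≤s () , _)
classifyStar (edgeless 2 , edgeless 0)   (() , _)
classifyStar (edgeless 2 , edgeless 1)   (s≤s () , _)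
classifyStar (edgeless 2 , edgeless 2)   (s≤s (s≤s ()) , _)
classifyStar (edgeless _ , edgeless (suc (suc (suc _)))) (_ , _ , s≤s (s≤s (s≤s ())))
classifyStar (edgeless (suc (suc (suc _))) , _) (_ , s≤s (s≤s (s≤s ())) , _)
classifyStar (path _ , edgeless _) (() , _)
classifyStar (path 0 , path 0) (() , _)
classifyStar (path 0 , path (suc _)) (_ , _ , s≤s ())
classifyStar (path (suc _) , _) (_ , s≤s () , _)

starClique< : ∀ {k p} → Token 3 1 p → StarToken k p → k < 3
starClique< (_ , k<3 , _) spoke = k<3
starClique< _             rim₀₁ = s≤s z≤n
starClique< _             rim₁₂ = s≤s (s≤s z≤n)
starClique< _             rim₀₂ = s≤s (s≤s (s≤s z≤n))

starTokens-adjacent : ∀ {k p q} → StarToken k p → StarToken k q → p ≡ q ⊎ TokenAdj p q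
starTokens-adjacent spoke spoke = inj₁ refl
starTokens-adjacent rim₀₁ rim₀₁ = inj₁ refl
starTokens-adjacent rim₁₂ rim₁₂ = inj₁ refl
starTokens-adjacent rim₀₂ rim₀₂ = inj₁ refl
starTokens-adjacent spoke rim₀₁ = inj₂ (_ , _ , _ , inj₁ refl , inj₁ refl , tt)
starTokens-adjacent spoke rim₁₂ = inj₂ (_ , _ , _ , inj₁ refl , inj₁ refl , tt)
starTokens-adjacent spoke rim₀₂ = inj₂ (_ , _ , _ , inj₁ refl , inj₂ refl , tt)
starTokens-adjacent rim₀₁ spoke = inj₂ (_ , _ , _ , inj₁ refl , inj₁ refl , tt)
starTokens-adjacent rim₁₂ spoke = inj₂ (_ , _ , _ , inj₁ refl , inj₁ refl , tt)
starTokens-adjacent rim₀₂ spoke = inj₂ (_ , _ , _ , inj₂ refl , inj₁ refl , tt)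

starCover : NewTokenCliqueCover 3 1 0 0 3
starCover = record
  { clique     = starClique
  ; clique<    = λ {p} tp _ → starClique< tp (classifyStar p tp)
  ; sameClique = λ {p} {q} tp tq _ _ eq →
      starTokens-adjacent (classifyStar p tp) (subst (λ k → StarToken k q) (sym eq) (classifyStar q tq))
  }

upperBound-generic : ∀ n m → ¬ Exceptional n m → IndependenceBound n m (size₂ n m)
upperBound-generic zero    zero    _ = noTokens
upperBound-generic zero    (suc m) _ =
  subst (IndependenceBound 0 (suc m)) (size₂-zero-suc m)
        (addPathVertex (upperBound-generic 0 m (¬exceptional-zeroˡ m)))
upperBound-generic (suc n) zero    _ =
  subst (IndependenceBound (suc n) 0) (trans (cong (n C 2 +_) (⊔-identityʳ n)) (sym (suc-C2 n)))
        (addEdgeless (upperBound-generic n 0 (¬exceptional-zeroʳ n)))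
upperBound-generic 1 1 ¬e = contradiction (inj₁ refl) ¬e
upperBound-generic 2 1 ¬e = contradiction (inj₂ refl) ¬e
upperBound-generic 3 1 _  = extend starCover noTokens
upperBound-generic (suc n@(suc (suc (suc _)))) 1 _ =
  subst (IndependenceBound (suc n) 1) (sym (suc-C2 n))
        (addEdgeless (upperBound-generic n 1 λ e → [ (λ ()) , (λ ()) ]′ (exceptional-oneʳ n e)))
upperBound-generic (suc n) (suc (suc m)) ¬e =
  subst (IndependenceBound (suc n) (suc (suc m))) (sym (size₂-step n m))
        (addTriangle (upperBound-generic n m (¬e ∘ exceptional-suc)))

upperBound-exceptional : ∀ n m → Exceptional n m → IndependenceBound n m (size₁ n m)
upperBound-exceptional zero    m       e = contradiction e (¬exceptional-zeroˡ m)
upperBound-exceptional (suc n) zero    e = contradiction e (¬exceptional-zeroʳ (suc n))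
upperBound-exceptional (suc n) 1       e with exceptional-oneʳ (suc n) e
... | inj₁ refl = addEdgeless (upperBound-generic 0 1 (¬exceptional-zeroˡ 1))
... | inj₂ refl = addEdgeless (upperBound-exceptional 1 1 (inj₁ refl))
upperBound-exceptional (suc n) (suc (suc m)) e =
  subst (IndependenceBound (suc n) (suc (suc m))) (sym (size₁-step n m))
        (addTriangle (upperBound-exceptional n m (exceptional-pred e)))

-- Lower bound

data Colour : Set where
  hub even odd : Colour

pathColour : ℕ → Colour
pathColour 0             = even
pathColour 1             = odd
pathColour (suc (suc j)) = pathColour j

colour : Vertex → Colour
colour (edgeless _) = hub
colour (path j)     = pathColour j

pathColour≢hub : ∀ j → pathColour j ≢ hub
pathColour≢hub 0             ()
pathColour≢hub 1             ()
pathColour≢hub (suc (suc j)) = pathColour≢hub j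

pathColour≢pathColour-suc : ∀ j → pathColour j ≢ pathColour (suc j)
pathColour≢pathColour-suc 0             ()
pathColour≢pathColour-suc 1             ()
pathColour≢pathColour-suc (suc (suc j)) = pathColour≢pathColour-suc j

colour-proper : ∀ {x y} → x ~ y → colour x ≢ colour y
colour-proper {edgeless _} {path j}     _           = pathColour≢hub j ∘ sym
colour-proper {path i}     {edgeless _} _           = pathColour≢hub i
colour-proper {path i}     {path _}     (inj₁ refl) = pathColour≢pathColour-suc i
colour-proper {path _}     {path j}     (inj₂ refl) = pathColour≢pathColour-suc j ∘ sym

pathColour-even : ∀ s → pathColour (2 * s) ≡ even
pathColour-even zero    = refl
pathColour-even (suc s) = subst (λ k → pathColour k ≡ even) (sym (*-suc 2 s)) (pathColour-even s)

pathColour-odd : ∀ s → pathColour (suc (2 * s)) ≡ odd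
pathColour-odd zero    = refl
pathColour-odd (suc s) = subst (λ k → pathColour (suc k) ≡ odd) (sym (*-suc 2 s)) (pathColour-odd s)

data Compatible (σ : Colour → Colour) : Pair → Set where
  compatible : ∀ {u v} → colour v ≡ σ (colour u) → colour u ≡ σ (colour v) → Compatible σ (u , v)

coloured : ∀ {σ u v c c′} → colour u ≡ c → colour v ≡ c′ → c′ ≡ σ c → c ≡ σ c′ → Compatible σ (u , v)
coloured refl refl = compatible

compatible-≐ : ∀ {σ p s x} → Compatible σ p → p ≐ (s , x) → colour x ≡ σ (colour s)
compatible-≐ (compatible c _) (inj₁ refl) = c
compatible-≐ (compatible _ c) (inj₂ refl) = c

compatible⇒independent : ∀ σ {S} → All (Compatible σ) S → Independent S
compatible⇒independent σ compat p∈ q∈ (s , x , y , p≐sx , q≐sy , x~y) =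
  colour-proper x~y
    (trans (compatible-≐ (All.lookup compat p∈) p≐sx) (sym (compatible-≐ (All.lookup compat q∈) q≐sy)))

swapHubEven swapEvenOdd : Colour → Colour
swapHubEven hub  = even
swapHubEven even = hub
swapHubEven odd  = odd
swapEvenOdd hub  = hub
swapEvenOdd even = odd
swapEvenOdd odd  = even

IndependentTokens : ℕ → ℕ → ℕ → Set
IndependentTokens n m k = ∃[ S ] (All (Token n m) S × Unique S × Independent S × length S ≡ k)

compatible⇒independentTokens : ∀ σ {n m S} → All (λ p → Token n m p × Compatible σ p) S → Unique S →
                    IndependentTokens n m (length S)
compatible⇒independentTokens σ {S = S} good unique =
  S , All.map proj₁ good , unique , compatible⇒independent σ (All.map proj₂ good) , refl

2*s<m : ∀ m {s} → s < ⌈ m /2⌉ → 2 * s < m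
2*s<m (suc _)       {zero}  _         = s≤s z≤n
2*s<m (suc zero)    {suc _} (s≤s ())
2*s<m (suc (suc m)) {suc s} (s≤s s<h) rewrite *-suc 2 s = s≤s (s≤s (2*s<m m s<h))

1+2*t<m : ∀ m {t} → t < ⌊ m /2⌋ → suc (2 * t) < m
1+2*t<m (suc (suc _)) {zero}  _         = s≤s (s≤s z≤n)
1+2*t<m (suc (suc m)) {suc t} (s≤s t<f) rewrite *-suc 2 t = s≤s (s≤s (1+2*t<m m t<f))

edgeless-injective : ∀ {i j} → edgeless i ≡ edgeless j → i ≡ j
edgeless-injective refl = refl

path-injective : ∀ {i j} → path i ≡ path j → i ≡ j
path-injective refl = refl

sortedPath : ℕ → ℕ → Pair
sortedPath i j with i <? j
... | yes _ = path i , path j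
... | no _  = path j , path i

hubEven oddOdd hubHub evenOdd : ℕ → ℕ → Pair
hubEven i s = edgeless i , path (2 * s)
oddOdd s t  = path (suc (2 * s)) , path (suc (2 * t))
hubHub i j  = edgeless i , edgeless j
evenOdd s t = sortedPath (2 * s) (suc (2 * t))

construction₁ construction₂ : ℕ → ℕ → List Pair
construction₁ n m = grid hubEven n ⌈ m /2⌉ ++ pairsBelow oddOdd ⌊ m /2⌋
construction₂ n m = pairsBelow hubHub n ++ grid evenOdd ⌈ m /2⌉ ⌊ m /2⌋

evenOdd-≐ : ∀ s t → evenOdd s t ≐ (path (2 * s) , path (suc (2 * t)))
evenOdd-≐ s t with 2 * s <? suc (2 * t)
... | yes _ = inj₁ refl
... | no _  = inj₂ refl

module _ (n m : ℕ) where

  hubEven-good : ∀ {i s} → i < n → s < ⌈ m /2⌉ → Token n m (hubEven i s) × Compatible swapHubEven (hubEven i s)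
  hubEven-good {s = s} i<n s<h = (tt , i<n , 2*s<m m s<h) , coloured refl (pathColour-even s) refl refl

  oddOdd-good : ∀ {s t} → s < t → t < ⌊ m /2⌋ → Token n m (oddOdd s t) × Compatible swapHubEven (oddOdd s t)
  oddOdd-good {s} {t} s<t t<f =
    (s≤s (*-monoʳ-< 2 s<t) , 1+2*t<m m (<-trans s<t t<f) , 1+2*t<m m t<f) ,
    coloured (pathColour-odd s) (pathColour-odd t) refl refl

  hubHub-good : ∀ {i j} → i < j → j < n → Token n m (hubHub i j) × Compatible swapEvenOdd (hubHub i j)
  hubHub-good i<j j<n = (i<j , <-trans i<j j<n , j<n) , coloured refl refl refl refl

  evenOdd-good : ∀ {s t} → s < ⌈ m /2⌉ → t < ⌊ m /2⌋ →
                 Token n m (evenOdd s t) × Compatible swapEvenOdd (evenOdd s t)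
  evenOdd-good {s} {t} s<h t<f with 2 * s <? suc (2 * t)
  ... | yes lt = (lt , 2*s<m m s<h , 1+2*t<m m t<f) , coloured (pathColour-even s) (pathColour-odd t) refl refl
  ... | no ≮  = (≤∧≢⇒< (≮⇒≥ ≮) (even≢odd s t ∘ sym) , 1+2*t<m m t<f , 2*s<m m s<h) ,
                coloured (pathColour-odd t) (pathColour-even s) refl refl

hubEven-injective : Injective₂ hubEven
hubEven-injective eq = let e₁ , e₂ = ,-injective eq in
  edgeless-injective e₁ , *-cancelˡ-≡ _ _ 2 (path-injective e₂)

oddOdd-injective : Injective₂ oddOdd
oddOdd-injective eq = let e₁ , e₂ = ,-injective eq in
  *-cancelˡ-≡ _ _ 2 (suc-injective (path-injective e₁)) , *-cancelˡ-≡ _ _ 2 (suc-injective (path-injective e₂))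

hubHub-injective : Injective₂ hubHub
hubHub-injective eq = let e₁ , e₂ = ,-injective eq in edgeless-injective e₁ , edgeless-injective e₂

evenOdd-injective : Injective₂ evenOdd
evenOdd-injective {s} {t} {s′} {t′} eq
  with ≐-agree (evenOdd-≐ s t) (subst (_≐ _) (sym eq) (evenOdd-≐ s′ t′))
... | inj₁ eq′ = let e₁ , e₂ = ,-injective eq′ in
  *-cancelˡ-≡ _ _ 2 (path-injective e₁) , *-cancelˡ-≡ _ _ 2 (suc-injective (path-injective e₂))
... | inj₂ eq′ = contradiction (path-injective (proj₁ (,-injective eq′))) (even≢odd s t′)

construction₁-independent : ∀ n m → IndependentTokens n m (size₁ n m)
construction₁-independent n m =
  subst (IndependentTokens n m) size
    (compatible⇒independentTokens swapHubEven (All.++⁺ (all-grid hubEven n ⌈ m /2⌉ (hubEven-good n m))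
                                             (all-pairsBelow oddOdd ⌊ m /2⌋ (oddOdd-good n m)))
                       (Unique.++⁺ (grid-unique n ⌈ m /2⌉ hubEven-injective)
                                   (pairsBelow-unique ⌊ m /2⌋ oddOdd-injective) disjoint))
  where
  size : length (construction₁ n m) ≡ size₁ n m
  size = trans (length-++ (grid hubEven n ⌈ m /2⌉))
               (cong₂ _+_ (length-grid hubEven n ⌈ m /2⌉) (length-pairsBelow oddOdd ⌊ m /2⌋))
  disjoint : ∀ {p} → ¬ (p ∈ grid hubEven n ⌈ m /2⌉ × p ∈ pairsBelow oddOdd ⌊ m /2⌋)
  disjoint (p∈grid , p∈pairs) with ∈-grid⁻ hubEven n ⌈ m /2⌉ p∈grid | ∈-pairsBelow⁻ oddOdd ⌊ m /2⌋ p∈pairs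
  ... | _ , _ , _ , _ , refl | _ , _ , _ , _ , ()

construction₂-independent : ∀ n m → IndependentTokens n m (size₂ n m)
construction₂-independent n m =
  subst (IndependentTokens n m) size
    (compatible⇒independentTokens swapEvenOdd (All.++⁺ (all-pairsBelow hubHub n (hubHub-good n m))
                                             (all-grid evenOdd ⌈ m /2⌉ ⌊ m /2⌋ (evenOdd-good n m)))
                       (Unique.++⁺ (pairsBelow-unique n hubHub-injective)
                                   (grid-unique ⌈ m /2⌉ ⌊ m /2⌋ evenOdd-injective) disjoint))
  where
  size : length (construction₂ n m) ≡ size₂ n m
  size = begin
    length (construction₂ n m)          ≡⟨ length-++ (pairsBelow hubHub n) ⟩
    length (pairsBelow hubHub n) + length (grid evenOdd ⌈ m /2⌉ ⌊ m /2⌋)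
      ≡⟨ cong₂ _+_ (length-pairsBelow hubHub n) (length-grid evenOdd ⌈ m /2⌉ ⌊ m /2⌋) ⟩
    n C 2 + ⌈ m /2⌉ * ⌊ m /2⌋            ≡⟨ +-comm (n C 2) _ ⟩
    ⌈ m /2⌉ * ⌊ m /2⌋ + n C 2            ≡⟨ cong (_+ n C 2) (*-comm ⌈ m /2⌉ ⌊ m /2⌋) ⟩
    size₂ n m                           ∎
    where open ≡-Reasoning
  disjoint : ∀ {p} → ¬ (p ∈ pairsBelow hubHub n × p ∈ grid evenOdd ⌈ m /2⌉ ⌊ m /2⌋)
  disjoint (p∈pairs , p∈grid) with ∈-pairsBelow⁻ hubHub n p∈pairs | ∈-grid⁻ evenOdd ⌈ m /2⌉ ⌊ m /2⌋ p∈grid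
  ... | _ , _ , _ , _ , refl | s , t , _ , _ , eq =
    [ (λ ()) , (λ ()) ]′ (subst (_≐ (path (2 * s) , path (suc (2 * t)))) (sym eq) (evenOdd-≐ s t))

-- The token graph F₂(F n m)

module _ (n m : ℕ) where

  vertexAt : Fin (n + m) → Vertex
  vertexAt i = [ edgeless ∘ toℕ , path ∘ toℕ ]′ (splitAt n i)

  toℕ≡position : ∀ i → toℕ i ≡ position n (vertexAt i)
  toℕ≡position i with splitAt n i in eq
  ... | inj₁ a = trans (sym (cong toℕ (Fin.splitAt⁻¹-↑ˡ eq))) (Fin.toℕ-↑ˡ a m)
  ... | inj₂ b = trans (sym (cong toℕ (Fin.splitAt⁻¹-↑ʳ eq))) (Fin.toℕ-↑ʳ n b)

  vertexAt-inRange : ∀ i → InRange n m (vertexAt i)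
  vertexAt-inRange i with splitAt n i
  ... | inj₁ a = Fin.toℕ<n a
  ... | inj₂ b = Fin.toℕ<n b

  vertexAt-injective : ∀ {i j} → vertexAt i ≡ vertexAt j → i ≡ j
  vertexAt-injective {i} {j} eq =
    Fin.toℕ-injective (trans (toℕ≡position i) (trans (cong (position n) eq) (sym (toℕ≡position j))))

  atVertex : ∀ v → InRange n m v → Fin (n + m)
  atVertex v v∈ = fromℕ< (position< v∈)

  vertexAt-atVertex : ∀ v v∈ → vertexAt (atVertex v v∈) ≡ v
  vertexAt-atVertex v v∈ =
    position-injective (vertexAt-inRange _) v∈ (trans (sym (toℕ≡position _)) (Fin.toℕ-fromℕ< _))

  F≡~ : ∀ i j → F n m i j ≡ (vertexAt i ~ vertexAt j)
  F≡~ i j with splitAt n i | splitAt n j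
  ... | inj₁ _ | inj₁ _ = refl
  ... | inj₁ _ | inj₂ _ = refl
  ... | inj₂ _ | inj₁ _ = refl
  ... | inj₂ _ | inj₂ _ = refl

  H : Graph
  H = TokenGraph₂ (F n m)

  tokenOf : V H → Pair
  tokenOf (s , ∣s∣≡2) = let i , j , _ = ∣p∣≡2⇒p≡pair s ∣s∣≡2 in vertexAt i , vertexAt j

  tokenOf-token : ∀ u → Token n m (tokenOf u)
  tokenOf-token (s , ∣s∣≡2) with ∣p∣≡2⇒p≡pair s ∣s∣≡2
  ... | i , j , i<j , _ =
    position-<⇒≺ (vertexAt-inRange j) (subst₂ _<_ (toℕ≡position i) (toℕ≡position j) i<j) ,
    vertexAt-inRange i , vertexAt-inRange j

  tokenOf-injective : ∀ {u v} → tokenOf u ≡ tokenOf v → u ≡ v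
  tokenOf-injective {s , ∣s∣≡2} {s′ , ∣s′∣≡2} eq with ∣p∣≡2⇒p≡pair s ∣s∣≡2 | ∣p∣≡2⇒p≡pair s′ ∣s′∣≡2
  ... | i , j , _ , s≡ij | k , l , _ , s′≡kl
    with refl ← vertexAt-injective (proj₁ (,-injective eq))
       | refl ← vertexAt-injective (proj₂ (,-injective eq))
    with refl ← trans s≡ij (sym s′≡kl)
    = cong (s ,_) (≡-irrelevant ∣s∣≡2 ∣s′∣≡2)

  tokenOf-onto : ∀ {p} → Token n m p → ∃[ u ] tokenOf u ≡ p
  tokenOf-onto {u , v} (u≺v , u∈ , v∈) = (pair a b , ∣pair∣≡2 a≢b) , decomposition
    where
    a = atVertex u u∈
    b = atVertex v v∈
    a<b : toℕ a < toℕ b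
    a<b = subst₂ _<_ (sym (Fin.toℕ-fromℕ< _)) (sym (Fin.toℕ-fromℕ< _)) (≺⇒position-< u∈ u≺v)
    a≢b : a ≢ b
    a≢b = Fin.<⇒≢ a<b
    decomposition : tokenOf (pair a b , ∣pair∣≡2 a≢b) ≡ (u , v)
    decomposition with ∣p∣≡2⇒p≡pair (pair a b) (∣pair∣≡2 a≢b)
    ... | i , j , i<j , ab≡ij with pair-injective a≢b ab≡ij
    ...   | inj₁ refl = cong₂ _,_ (vertexAt-atVertex u u∈) (vertexAt-atVertex v v∈)
    ...   | inj₂ refl = contradiction i<j (<-asym a<b)

  F⇒~ : ∀ {i j} → F n m i j → vertexAt i ~ vertexAt j
  F⇒~ {i} {j} = subst id (F≡~ i j)

  ~⇒F : ∀ {i j} → vertexAt i ~ vertexAt j → F n m i j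
  ~⇒F {i} {j} = subst id (sym (F≡~ i j))

  Adj⇒TokenAdj : ∀ u v → Adj H u v → TokenAdj (tokenOf u) (tokenOf v)
  Adj⇒TokenAdj (s , ∣s∣≡2) (s′ , ∣s′∣≡2) (x , y , Fxy , eq) with ∣p∣≡2⇒p≡pair s ∣s∣≡2 | ∣p∣≡2⇒p≡pair s′ ∣s′∣≡2
  ... | i , j , i<j , refl | k , l , k<l , refl
    with a , b , c , ij≐ab , kl≐ac , xy≐bc
           ← symdiff≡pair⇒shared (Fin.<⇒≢ i<j) (Fin.<⇒≢ k<l) (λ { refl → ~-irrefl (F⇒~ Fxy) }) eq
    = vertexAt a , vertexAt b , vertexAt c , ≐-cong vertexAt ij≐ab , ≐-cong vertexAt kl≐ac ,
      ~-resp-≐ (F⇒~ Fxy) (≐-cong vertexAt xy≐bc)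

  TokenAdj⇒Adj : ∀ u v → TokenAdj (tokenOf u) (tokenOf v) → Adj H u v
  TokenAdj⇒Adj (s , ∣s∣≡2) (s′ , ∣s′∣≡2) (_ , _ , _ , hp , hq , b~c)
    with ∣p∣≡2⇒p≡pair s ∣s∣≡2 | ∣p∣≡2⇒p≡pair s′ ∣s′∣≡2
  ... | i , j , i<j , refl | k , l , k<l , refl
    with a , b , ij≐ab , refl , refl ← ≐-pullback vertexAt hp
       | a′ , c , kl≐a′c , a′↦a , refl ← ≐-pullback vertexAt hq
    with refl ← vertexAt-injective a′↦a
    = b , c , ~⇒F b~c ,
      trans (cong₂ symdiff (≐⇒pair≡ ij≐ab) (≐⇒pair≡ kl≐a′c))
            (symdiff-pair-pair (≢-resp-≐ (Fin.<⇒≢ i<j) ij≐ab) (≢-resp-≐ (Fin.<⇒≢ k<l) kl≐a′c)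
                               (λ { refl → ~-irrefl b~c }))

  independenceNumber : ∀ {k} → IndependentTokens n m k → IndependenceBound n m k → IndependenceNumber H k
  independenceNumber {k} (L , tokens , unique , independent , refl) bound = lower , upper
    where
    preimage = preimage-list (All.map tokenOf-onto tokens)
    S = proj₁ preimage
    S↦L : map tokenOf S ≡ L
    S↦L = proj₂ preimage

    lower : ∃[ S ] (IsIndependent H S × length S ≡ length L)
    lower = S , (Unique.map⁻ (subst Unique (sym S↦L) unique) , S-independent) ,
            trans (sym (length-map tokenOf S)) (cong length S↦L)
      where
      S-independent : ∀ {u v} → u ∈ S → v ∈ S → ¬ Adj H u v
      S-independent {u} {v} u∈ v∈ adj =
        independent (subst (tokenOf u ∈_) S↦L (∈-map⁺ tokenOf u∈))
                    (subst (tokenOf v ∈_) S↦L (∈-map⁺ tokenOf v∈))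
                    (Adj⇒TokenAdj u v adj)

    upper : ∀ S → IsIndependent H S → length S ≤ length L
    upper S (S-unique , S-independent) = begin
      length S                ≡⟨ length-map tokenOf S ⟨
      length (map tokenOf S)  ≤⟨ bound (map tokenOf S) (All.map⁺ (All.tabulate λ {u} _ → tokenOf-token u))
                                       (Unique.map⁺ tokenOf-injective S-unique) tokens-independent ⟩
      length L                ∎
      where
      open ≤-Reasoning
      tokens-independent : Independent (map tokenOf S)
      tokens-independent p∈ q∈ adj with ∈-map⁻ tokenOf p∈ | ∈-map⁻ tokenOf q∈
      ... | u , u∈ , refl | v , v∈ , refl = S-independent u∈ v∈ (TokenAdj⇒Adj u v adj)

theorem5 : (n m : ℕ) → 1 ≤ n → 1 ≤ m →
    (((2 * n ≡ m + 1) ⊎ (2 * n ≡ m + 3)) →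
        IndependenceNumber (TokenGraph₂ (F n m)) (n * ⌈ m /2⌉ + ⌊ m /2⌋ C 2))
    ×
    (¬ ((2 * n ≡ m + 1) ⊎ (2 * n ≡ m + 3)) →
        IndependenceNumber (TokenGraph₂ (F n m)) ((m * m) / 4 + n C 2))
-- The formula holds for n = 0 and m = 0 as well.
theorem5 n m _ _ = exceptional , generic
  where
  exceptional : Exceptional n m → IndependenceNumber (TokenGraph₂ (F n m)) (size₁ n m)
  exceptional e = independenceNumber n m (construction₁-independent n m) (upperBound-exceptional n m e)

  generic : ¬ Exceptional n m → IndependenceNumber (TokenGraph₂ (F n m)) ((m * m) / 4 + n C 2)
  generic ¬e = subst (IndependenceNumber (TokenGraph₂ (F n m))) (cong (_+ n C 2) (sym (m*m/4≡⌊m/2⌋*⌈m/2⌉ m)))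
                     (independenceNumber n m (construction₂-independent n m) (upperBound-generic n m ¬e))
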